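{- Let $k,n,m$ be integers with $3\leq k\leq mn$, $n\geq 3$ and $m\geq 3$. Then (1) $m+n-2\leq sdiam_k(P_n\Box P_m)\leq m+n-2+(k-3)\min\{m-1,n-1\}$; (2) $sdiam_k(P_n\circ P_m)\leq n+k-3$, and $sdiam_k(P_n\circ P_m)\geq n-1$ if $m+1\leq k\leq mn$, while $sdiam_k(P_n\circ P_m)\geq k-1$ if $2\leq k\leq m$.
   Context: $P_n$ is the path on $n$ vertices. For a connected graph $F$ and $S\subseteq V(F)$, the Steiner distance $d_F(S)$ is the minimum number of edges of a connected subgraph of $F$ whose vertex set contains $S$; $sdiam_k(F)=\max\{d_F(S): S\subseteq V(F),\ |S|=k\}$. The Cartesian product $G\Box H$ has vertex set $V(G)\times V(H)$, with $(g,h)\sim(g',h')$ iff either $g=g'$ and $hh'\in E(H)$, or $h=h'$ and $gg'\in E(G)$. The lexicographic product $G\circ H$ has vertex set $V(G)\times V(H)$, with distinct $(g,h),(g',h')$ adjacent iff $gg'\in E(G)$, or $g=g'$ and $hh'\in E(H)$. -}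

module Defs where

open import Level using (0ℓ)
open import Data.Nat using (ℕ; zero; suc; _≤_)
open import Data.Fin using (Fin; toℕ)
open import Data.Product using (Σ; _×_; _,_; ∃)
open import Data.Sum using (_⊎_)
open import Data.List using (List; length)
open import Data.List.Membership.Propositional using (_∈_)
open import Data.List.Relation.Unary.All using (All)
open import Data.List.Relation.Unary.AllPairs using (AllPairs)
open import Data.List.Relation.Unary.Unique.Propositional using (Unique)
open import Relation.Nullary using (¬_)
open import Relation.Binary.PropositionalEquality using (_≡_)

record Graph : Set₁ where
  field
    V   : Set
    Adj : V → V → Set
open Graph public

P : ℕ → Graph
P n = record { V = Fin n
             ; Adj = λ i j → (toℕ i ≡ suc (toℕ j)) ⊎ (toℕ j ≡ suc (toℕ i)) }

_□_ : Graph → Graph → Graph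
G □ H = record
  { V = V G × V H
  ; Adj = λ { (g , h) (g' , h') →
        (g ≡ g' × Adj H h h') ⊎ (h ≡ h' × Adj G g g') } }

_⊙_ : Graph → Graph → Graph
G ⊙ H = record
  { V = V G × V H
  ; Adj = λ { (g , h) (g' , h') →
        ¬ ((g , h) ≡ (g' , h')) × (Adj G g g' ⊎ (g ≡ g' × Adj H h h')) } }

module _ (G : Graph) where

  Edge : Set
  Edge = V G × V G

  -- two ordered pairs describe the same unordered edge
  SameEdge : Edge → Edge → Set
  SameEdge (a , b) (c , d) = (a ≡ c × b ≡ d) ⊎ (a ≡ d × b ≡ c)

  EdgeIn : List Edge → V G → V G → Set
  EdgeIn E u w = ((u , w) ∈ E) ⊎ ((w , u) ∈ E)

  data Walk (E : List Edge) : V G → V G → Set where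
    here : ∀ {u} → Walk E u u
    step : ∀ {u w v} → EdgeIn E u w → Walk E w v → Walk E u v

  record Subgraph : Set where
    field
      W      : List (V G)
      E      : List Edge
      W-uniq : Unique W
      E-uniq : AllPairs (λ e f → ¬ SameEdge e f) E
      E-adj  : All (λ e → Adj G (Data.Product.proj₁ e) (Data.Product.proj₂ e)) E
      E-ends : All (λ e → (Data.Product.proj₁ e ∈ W) × (Data.Product.proj₂ e ∈ W)) E
  open Subgraph public

  numEdges : Subgraph → ℕ
  numEdges H = length (E H)

  Connected : Subgraph → Set
  Connected H = ∀ {u v} → u ∈ W H → v ∈ W H → Walk (E H) u v

  Spans : List (V G) → Subgraph → Set
  Spans S H = Connected H × All (λ s → s ∈ W H) S

  IsSteinerDist : List (V G) → ℕ → Set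
  IsSteinerDist S d =
    (Σ Subgraph λ H → Spans S H × numEdges H ≡ d) ×
    (∀ H → Spans S H → d ≤ numEdges H)

  KSubset : ℕ → List (V G) → Set
  KSubset k S = Unique S × length S ≡ k

  IsSdiam : ℕ → ℕ → Set
  IsSdiam k D =
    (∀ S d → KSubset k S → IsSteinerDist S d → d ≤ D) ×
    (Σ (List (V G)) λ S → KSubset k S × IsSteinerDist S D)

module Submission where

-- Since the statement asserts that sdiam_k exists, the proof has three layers.
--
-- 1. Steiner trees as edge lists.  A "certificate" for a vertex list S is a
--    list of edges of G connecting S together with all edge endpoints.  Every
--    connected subgraph spanning S gives one, and every certificate yields such
--    a subgraph with at most as many edges (after removing repeated edges).
-- 2. Existence of sdiam_k.  For a finite graph with decidable adjacency,
--    "S has a certificate with at most b edges" is decidable (walks are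
--    decidable, edge lists of bounded length can be enumerated).  Given a
--    uniform upper bound U over all k-subsets, the least uniform bound D exists,
--    equals sdiam_k, and is at least any lower bound on d(S) for a single k-subset S.
-- 3. Bounds.  Lower bounds: a potential that changes by at most one along
--    edges forces one edge per level crossed; a connected subgraph containing
--    k vertices has at least k - 1 edges.  Upper bounds: certificates are
--    grown by attaching vertices along paths, paying one edge per step.
--
-- Part (1), the grid: the comb (a full row at the median height of three of
-- the vertices, plus column segments to all vertices) gives the upper bound,
-- applied to the grid or its transpose; opposite corners and the potential
-- i + j give m + n - 2.  Part (2), the lexicographic product: a star, or a
-- column plus one edge per further vertex, gives n + k - 3; the layer
-- potential and the counting bound give n - 1 and k - 1.  The theorem is
-- assembled at the end from the two parts.

open import Defs
open import Data.Nat using (ℕ; zero; suc; _+_; _*_; _∸_; _≤_; _<_; z≤n; s≤s; _⊓_; ∣_-_∣; _≤?_; _<?_)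
import Data.Nat as ℕ
open import Data.Nat.Properties
open import Data.Product using (Σ; ∃; _×_; _,_; proj₁; proj₂; swap)
open import Data.Product.Properties using (≡-dec)
open import Data.Sum using (_⊎_; inj₁; inj₂; [_,_]′) renaming (swap to swap⊎; map to map⊎)
open import Data.Empty using (⊥-elim)
open import Data.Unit using (⊤; tt)
open import Data.Fin using (Fin; toℕ; fromℕ) renaming (zero to fzero; suc to fsuc)
import Data.Fin.Properties as Fin
open import Data.List using (List; []; _∷_; length; _++_; map; filter; take; upTo; allFin; cartesianProduct; deduplicate)
open import Data.List.Properties using (map-∘; map-id; length-map; length-upTo; length-take; length-tabulate; length-++; map-++)
open import Data.List.Membership.Propositional using (_∈_; find)
open import Data.List.Membership.Propositional.Properties
open import Data.List.Relation.Unary.Any as Any using (Any; here; there)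
open import Data.List.Relation.Unary.All as All using (All; []; _∷_)
import Data.List.Relation.Unary.All.Properties as All
open import Data.List.Relation.Unary.AllPairs using (AllPairs; []; _∷_; allPairs?)
open import Data.List.Relation.Unary.Unique.Propositional using (Unique)
open import Data.List.Relation.Unary.Unique.Propositional.Properties using (upTo⁺; take⁺; filter⁺; cartesianProduct⁺; allFin⁺)
import Data.List.Relation.Unary.Unique.DecPropositional.Properties as Unique
open import Data.Vec using (Vec; toList; fromList) renaming ([] to []ᵛ; _∷_ to _∷ᵛ_)
open import Data.Vec.Properties using (toList∘fromList; length-toList)
open import Function using (_∘_)
open import Relation.Nullary using (¬_; Dec; yes; no)
open import Relation.Nullary.Decidable using (map′; _×-dec_; _⊎-dec_; ¬?; decidable-stable)
open import Relation.Unary using (Decidable)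
open import Relation.Binary.PropositionalEquality
open import Relation.Binary.Definitions using (DecidableEquality)

-- Counting with duplicate-free lists.
module _ {A : Set} where

  remove : (R : List A) {x : A} → x ∈ R → List A
  remove (_ ∷ R) (here _) = R
  remove (y ∷ R) (there p) = y ∷ remove R p

  length-remove : ∀ R {x} (p : x ∈ R) → suc (length (remove R p)) ≡ length R
  length-remove (_ ∷ R) (here _) = refl
  length-remove (y ∷ R) (there p) = cong suc (length-remove R p)

  ∈-remove : ∀ R {x y} (p : x ∈ R) → y ∈ R → ¬ y ≡ x → y ∈ remove R p
  ∈-remove (_ ∷ R) (here refl) (here refl) y≢x = ⊥-elim (y≢x refl)
  ∈-remove (_ ∷ R) (here refl) (there q) _ = q
  ∈-remove (_ ∷ R) (there p) (here q) _ = here q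
  ∈-remove (_ ∷ R) (there p) (there q) y≢x = there (∈-remove R p q y≢x)

  unique-⊆-length : ∀ (X R : List A) → Unique X → (∀ {x} → x ∈ X → x ∈ R) → length X ≤ length R
  unique-⊆-length [] R _ _ = z≤n
  unique-⊆-length (x ∷ X) R (x∉X ∷ uX) X⊆R =
    subst (suc (length X) ≤_) (length-remove R x∈R)
      (s≤s (unique-⊆-length X (remove R x∈R) uX
        (λ y∈X → ∈-remove R x∈R (X⊆R (there y∈X)) (λ y≡x → All.lookup x∉X y∈X (sym y≡x)))))
    where x∈R = X⊆R (here refl)

  length-filter-split : ∀ {P : A → Set} (P? : Decidable P) xs →
    length (filter P? xs) + length (filter (¬? ∘ P?) xs) ≡ length xs
  length-filter-split P? [] = refl
  length-filter-split P? (x ∷ xs) with P? x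
  ... | yes _ = cong suc (length-filter-split P? xs)
  ... | no _ = trans (+-suc _ _) (cong suc (length-filter-split P? xs))

  take-⊆ : ∀ k (xs : List A) {y} → y ∈ take k xs → y ∈ xs
  take-⊆ (suc k) (x ∷ xs) (here p) = here p
  take-⊆ (suc k) (x ∷ xs) (there p) = there (take-⊆ k xs p)

  take-kSubset : ∀ k (L : List A) → Unique L → k ≤ length L → Unique (take k L) × length (take k L) ≡ k
  take-kSubset k L uL k≤ = take⁺ k uL , trans (length-take k L) (m≤n⇒m⊓n≡m k≤)

  module Besides (_≟_ : DecidableEquality A) (a b : A) (a≢b : ¬ a ≡ b) where
    Other : A → Set
    Other x = ¬ x ≡ a × ¬ x ≡ b

    Other? : Decidable Other
    Other? x = ¬? (x ≟ a) ×-dec ¬? (x ≟ b)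

    not-other : ∀ {x} → ¬ Other x → x ∈ a ∷ b ∷ []
    not-other {x} ¬o with x ≟ a | x ≟ b
    ... | yes x≡a | _ = here x≡a
    ... | no _ | yes x≡b = there (here x≡b)
    ... | no x≢a | no x≢b = ⊥-elim (¬o (x≢a , x≢b))

    others : List A → List A
    others = filter Other?

    length-others-≥ : ∀ L → Unique L → length L ≤ length (others L) + 2
    length-others-≥ L uL = subst (_≤ length (others L) + 2) (length-filter-split Other? L)
      (+-monoʳ-≤ (length (others L))
        (unique-⊆-length (filter (¬? ∘ Other?) L) (a ∷ b ∷ []) (filter⁺ (¬? ∘ Other?) uL)
          (λ y∈ → not-other (proj₂ (∈-filter⁻ (¬? ∘ Other?) {xs = L} y∈)))))

    length-others-≤ : ∀ L → a ∈ L → b ∈ L → length (others L) + 2 ≤ length L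
    length-others-≤ L a∈ b∈ = subst (length (others L) + 2 ≤_) (length-filter-split Other? L)
      (+-monoʳ-≤ (length (others L))
        (unique-⊆-length (a ∷ b ∷ []) (filter (¬? ∘ Other?) L) ((a≢b ∷ []) ∷ [] ∷ [])
          λ { (here refl) → ∈-filter⁺ (¬? ∘ Other?) a∈ (λ o → proj₁ o refl)
            ; (there (here refl)) → ∈-filter⁺ (¬? ∘ Other?) b∈ (λ o → proj₂ o refl) }))

    all-from-others : ∀ {T : A → Set} L → All T (others L) → T a → T b → All T L
    all-from-others {T} L T-others Ta Tb = All.tabulate (λ {y} → holds y)
      where
      holds : ∀ y → y ∈ L → T y
      holds y y∈ with Other? y
      ... | yes o = All.lookup T-others (∈-filter⁺ Other? y∈ o)
      ... | no ¬o with not-other ¬o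
      ...   | here refl = Ta
      ...   | there (here refl) = Tb

    kSubset-through : ∀ k L → Unique L → a ∈ L → b ∈ L → 2 ≤ k → k ≤ length L →
      Σ (List A) λ S → (Unique S × length S ≡ k) × a ∈ S × b ∈ S
    kSubset-through k L uL a∈ b∈ 2≤k k≤ = a ∷ b ∷ T , (uS , lenS) , here refl , there (here refl)
      where
      T = take (k ∸ 2) (others L)
      other-T : ∀ {y} → y ∈ T → Other y
      other-T y∈ = proj₂ (∈-filter⁻ Other? {xs = L} (take-⊆ (k ∸ 2) (others L) y∈))
      uS : Unique (a ∷ b ∷ T)
      uS = (a≢b ∷ All.tabulate (λ y∈ a≡y → proj₁ (other-T y∈) (sym a≡y)))
         ∷ All.tabulate (λ y∈ b≡y → proj₂ (other-T y∈) (sym b≡y))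
         ∷ take⁺ (k ∸ 2) (filter⁺ Other? uL)
      enough : k ∸ 2 ≤ length (others L)
      enough = ≤-trans (∸-monoˡ-≤ 2 k≤)
        (subst (length L ∸ 2 ≤_) (m+n∸n≡m (length (others L)) 2) (∸-monoˡ-≤ 2 (length-others-≥ L uL)))
      lenS : length (a ∷ b ∷ T) ≡ k
      lenS = trans (cong (λ z → suc (suc z)) (proj₂ (take-kSubset (k ∸ 2) (others L) (filter⁺ Other? uL) enough)))
                   (trans (+-comm 2 (k ∸ 2)) (m∸n+n≡m 2≤k))

  min-by : (f : A → ℕ) (x : A) (L : List A) → Σ A λ a → a ∈ x ∷ L × (∀ {y} → y ∈ x ∷ L → f a ≤ f y)
  min-by f x [] = x , here refl , λ { (here refl) → ≤-refl }
  min-by f x (z ∷ L) with min-by f z L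
  ... | a , a∈ , a-min with f x ≤? f a
  ...   | yes fx≤fa = x , here refl , λ { (here refl) → ≤-refl ; (there p) → ≤-trans fx≤fa (a-min p) }
  ...   | no fx≰fa = a , there a∈ , λ { (here refl) → <⇒≤ (≰⇒> fx≰fa) ; (there p) → a-min p }

  max-by : (f : A → ℕ) (x : A) (L : List A) → Σ A λ b → b ∈ x ∷ L × (∀ {y} → y ∈ x ∷ L → f y ≤ f b)
  max-by f x [] = x , here refl , λ { (here refl) → ≤-refl }
  max-by f x (z ∷ L) with max-by f z L
  ... | b , b∈ , b-max with f b ≤? f x
  ...   | yes fb≤fx = x , here refl , λ { (here refl) → ≤-refl ; (there p) → ≤-trans (b-max p) fb≤fx }
  ...   | no fb≰fx = b , there b∈ , λ { (here refl) → <⇒≤ (≰⇒> fb≰fx) ; (there p) → b-max p }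

Searchable : Set → Set₁
Searchable A = ∀ {P : A → Set} → Decidable P → Dec (∃ P)

searchable-× : ∀ {A B} → Searchable A → Searchable B → Searchable (A × B)
searchable-× searchA searchB P? =
  map′ (λ { (a , b , p) → (a , b) , p }) (λ { ((a , b) , p) → a , b , p })
       (searchA (λ a → searchB (λ b → P? (a , b))))

searchable-Vec : ∀ {A} → Searchable A → ∀ k → Searchable (Vec A k)
searchable-Vec searchA zero P? = map′ ([]ᵛ ,_) (λ { ([]ᵛ , p) → p }) (P? []ᵛ)
searchable-Vec searchA (suc k) P? =
  map′ (λ { (x , xs , p) → (x ∷ᵛ xs) , p }) (λ { ((x ∷ᵛ xs) , p) → x , xs , p })
       (searchA (λ x → searchable-Vec searchA k (λ xs → P? (x ∷ᵛ xs))))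

least-witness : ∀ {P : ℕ → Set} → Decidable P → ∀ U → (∃ λ j → j < U × P j) →
  Σ ℕ λ B → P B × B < U × (∀ j → j < B → ¬ P j)
least-witness P? (suc U) witness with anyUpTo? P? U
... | yes smaller = let B , PB , B<U , least = least-witness P? U smaller
                    in B , PB , m≤n⇒m≤1+n B<U , least
... | no none = let j , j<1+U , Pj = witness
                in j , Pj , j<1+U , λ i i<j Pi → none (i , <-≤-trans i<j (≤-pred j<1+U) , Pi)

module Walks (G : Graph) where

  _++ʷ_ : ∀ {Es u v w} → Walk G Es u v → Walk G Es v w → Walk G Es u w
  here ++ʷ q = q
  step e p ++ʷ q = step e (p ++ʷ q)

  reverseʷ : ∀ {Es u v} → Walk G Es u v → Walk G Es v u
  reverseʷ here = here
  reverseʷ (step e p) = reverseʷ p ++ʷ step (swap⊎ e) here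

  mapʷ : ∀ {Es Es' u v} → (∀ {x} → x ∈ Es → x ∈ Es') → Walk G Es u v → Walk G Es' u v
  mapʷ f here = here
  mapʷ f (step (inj₁ p) w) = step (inj₁ (f p)) (mapʷ f w)
  mapʷ f (step (inj₂ p) w) = step (inj₂ (f p)) (mapʷ f w)

  weakenʷ : ∀ {e Es u v} → Walk G Es u v → Walk G (e ∷ Es) u v
  weakenʷ = mapʷ there

  first-edgeʷ : ∀ {a b Es} → Walk G ((a , b) ∷ Es) a b
  first-edgeʷ = step (inj₁ (here refl)) here

  walk-[] : ∀ {u v} → Walk G [] u v → u ≡ v
  walk-[] here = refl
  walk-[] (step (inj₁ ()) _)
  walk-[] (step (inj₂ ()) _)

  SplitWalk : ∀ a b → List (Edge G) → V G → V G → Set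
  SplitWalk a b Es u v =
    Walk G Es u v ⊎ (Walk G Es u a × Walk G Es b v) ⊎ (Walk G Es u b × Walk G Es a v)

  split-first-edge : ∀ {a b Es u v} → Walk G ((a , b) ∷ Es) u v → SplitWalk a b Es u v
  split-first-edge here = inj₁ here
  split-first-edge {a} {b} {Es} {u} (step {w = w} uw rest) = glue (classify uw) (split-first-edge rest)
    where
    classify : EdgeIn G ((a , b) ∷ Es) u w → EdgeIn G Es u w ⊎ ((u ≡ a × w ≡ b) ⊎ (u ≡ b × w ≡ a))
    classify (inj₁ (here refl)) = inj₂ (inj₁ (refl , refl))
    classify (inj₁ (there p)) = inj₁ (inj₁ p)
    classify (inj₂ (here refl)) = inj₂ (inj₂ (refl , refl))
    classify (inj₂ (there p)) = inj₁ (inj₂ p)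
    glue : ∀ {v} → EdgeIn G Es u w ⊎ ((u ≡ a × w ≡ b) ⊎ (u ≡ b × w ≡ a)) →
           SplitWalk a b Es w v → SplitWalk a b Es u v
    glue (inj₁ e) (inj₁ p) = inj₁ (step e p)
    glue (inj₁ e) (inj₂ (inj₁ (p , q))) = inj₂ (inj₁ (step e p , q))
    glue (inj₁ e) (inj₂ (inj₂ (p , q))) = inj₂ (inj₂ (step e p , q))
    glue (inj₂ (inj₁ (refl , refl))) (inj₁ p) = inj₂ (inj₁ (here , p))
    glue (inj₂ (inj₁ (refl , refl))) (inj₂ (inj₁ (p , q))) = inj₂ (inj₁ (here , q))
    glue (inj₂ (inj₁ (refl , refl))) (inj₂ (inj₂ (p , q))) = inj₁ q
    glue (inj₂ (inj₂ (refl , refl))) (inj₁ p) = inj₂ (inj₂ (here , p))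
    glue (inj₂ (inj₂ (refl , refl))) (inj₂ (inj₁ (p , q))) = inj₁ q
    glue (inj₂ (inj₂ (refl , refl))) (inj₂ (inj₂ (p , q))) = inj₂ (inj₂ (here , q))

  join-first-edge : ∀ {a b Es u v} → SplitWalk a b Es u v → Walk G ((a , b) ∷ Es) u v
  join-first-edge (inj₁ p) = weakenʷ p
  join-first-edge (inj₂ (inj₁ (p , q))) = weakenʷ p ++ʷ (first-edgeʷ ++ʷ weakenʷ q)
  join-first-edge (inj₂ (inj₂ (p , q))) = weakenʷ p ++ʷ (reverseʷ first-edgeʷ ++ʷ weakenʷ q)

module Certificates (G : Graph) where
  open Walks G

  endpoints : List (Edge G) → List (V G)
  endpoints [] = []
  endpoints ((a , b) ∷ Es) = a ∷ b ∷ endpoints Es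

  AllConnected : List (Edge G) → List (V G) → Set
  AllConnected Es X = All (λ u → All (λ v → Walk G Es u v) X) X

  walk-between : ∀ {Es X u v} → AllConnected Es X → u ∈ X → v ∈ X → Walk G Es u v
  walk-between c u∈ v∈ = All.lookup (All.lookup c u∈) v∈

  all-connected : ∀ {Es X} → (∀ {u v} → u ∈ X → v ∈ X → Walk G Es u v) → AllConnected Es X
  all-connected f = All.tabulate (λ u∈ → All.tabulate (λ v∈ → f u∈ v∈))

  IsEdge : Edge G → Set
  IsEdge e = Adj G (proj₁ e) (proj₂ e)

  Certificate : List (V G) → List (Edge G) → Set
  Certificate S Es = All IsEdge Es × AllConnected Es (S ++ endpoints Es)

  SmallCertificate : List (V G) → ℕ → Set
  SmallCertificate S b = Σ (List (Edge G)) λ Es → length Es ≤ b × Certificate S Es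

  small-weaken : ∀ {S b b'} → b ≤ b' → SmallCertificate S b → SmallCertificate S b'
  small-weaken b≤b' (Es , len≤ , cert) = Es , ≤-trans len≤ b≤b' , cert

  endpoint-of : ∀ {x} Es → x ∈ endpoints Es → ∃ λ e → e ∈ Es × (x ≡ proj₁ e ⊎ x ≡ proj₂ e)
  endpoint-of ((a , b) ∷ Es) (here p) = (a , b) , here refl , inj₁ p
  endpoint-of ((a , b) ∷ Es) (there (here p)) = _ , here refl , inj₂ p
  endpoint-of (e ∷ Es) (there (there p)) =
    let f , f∈ , q = endpoint-of Es p in f , there f∈ , q

  ∈-endpoints : ∀ {e} Es → e ∈ Es → proj₁ e ∈ endpoints Es × proj₂ e ∈ endpoints Es
  ∈-endpoints (e ∷ Es) (here refl) = here refl , there (here refl)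
  ∈-endpoints ((a , b) ∷ Es) (there p) =
    let q₁ , q₂ = ∈-endpoints Es p in there (there q₁) , there (there q₂)

  spanning⇒certificate : ∀ S H → Spans G S H → Certificate S (E H)
  spanning⇒certificate S H (conn , S⊆W) =
    E-adj H , all-connected λ u∈ v∈ → conn (in-W u∈) (in-W v∈)
    where
    in-W : ∀ {x} → x ∈ S ++ endpoints (E H) → x ∈ W H
    in-W p with ∈-++⁻ S p
    ... | inj₁ q = All.lookup S⊆W q
    ... | inj₂ q with endpoint-of (E H) q
    ...   | e , e∈ , inj₁ refl = proj₁ (All.lookup (E-ends H) e∈)
    ...   | e , e∈ , inj₂ refl = proj₂ (All.lookup (E-ends H) e∈)

  SteinerLowerBound : List (V G) → ℕ → Set
  SteinerLowerBound S L = ∀ H → Spans G S H → L ≤ numEdges G H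

-- A walk
-- from φ ≤ t to φ > t uses an edge whose lower endpoint has potential exactly t,
-- so connecting a vertex of potential 0 with one of potential ≥ L needs L edges.
module PotentialBound (G : Graph) (φ : V G → ℕ)
    (φ-step : ∀ {a b} → Adj G a b → φ a ≤ suc (φ b) × φ b ≤ suc (φ a)) where
  open Certificates G

  level : Edge G → ℕ
  level e = φ (proj₁ e) ⊓ φ (proj₂ e)

  crossing-level : ∀ {x y t} → x ≤ t → t < y → y ≤ suc x → x ⊓ y ≡ t × y ⊓ x ≡ t
  crossing-level {x} {y} {t} x≤t t<y y≤1+x =
    trans (m≤n⇒m⊓n≡m x≤y) x≡t , trans (m≥n⇒m⊓n≡n x≤y) x≡t
    where
    x≡t : x ≡ t
    x≡t = ≤-antisym x≤t (≤-pred (≤-trans t<y y≤1+x))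
    x≤y : x ≤ y
    x≤y = ≤-trans x≤t (<⇒≤ t<y)

  crossing-edge : ∀ {Es u v t} → All IsEdge Es → Walk G Es u v → φ u ≤ t → t < φ v →
    ∃ λ e → e ∈ Es × level e ≡ t
  crossing-edge _ here u≤t t<u = ⊥-elim (<⇒≱ t<u u≤t)
  crossing-edge {t = t} edges (step {w = w} _ rest) u≤t t<v with t <? φ w
  crossing-edge edges (step _ rest) u≤t t<v | no t≮w = crossing-edge edges rest (≮⇒≥ t≮w) t<v
  crossing-edge {u = u} edges (step {w = w} (inj₁ p) _) u≤t _ | yes t<w =
    (u , w) , p , proj₁ (crossing-level u≤t t<w (proj₂ (φ-step (All.lookup edges p))))
  crossing-edge {u = u} edges (step {w = w} (inj₂ p) _) u≤t _ | yes t<w =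
    (w , u) , p , proj₂ (crossing-level u≤t t<w (proj₁ (φ-step (All.lookup edges p))))

  levels-bound : ∀ Es L → (∀ t → t < L → ∃ λ e → e ∈ Es × level e ≡ t) → L ≤ length Es
  levels-bound Es L has-level = subst₂ _≤_ (length-upTo L) (length-map level Es)
    (unique-⊆-length (upTo L) (map level Es) (upTo⁺ L) λ t∈ →
      let e , e∈ , eq = has-level _ (∈-upTo⁻ t∈) in subst (_∈ map level Es) eq (∈-map⁺ level e∈))

  potential-lower-bound : ∀ S {u v} → u ∈ S → v ∈ S → φ u ≡ 0 → ∀ L → L ≤ φ v → SteinerLowerBound S L
  potential-lower-bound S u∈S v∈S φu≡0 L L≤φv H (conn , S⊆W) = levels-bound (E H) L λ t t<L →
    crossing-edge (E-adj H) (conn (All.lookup S⊆W u∈S) (All.lookup S⊆W v∈S))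
      (subst (_≤ t) (sym φu≡0) z≤n) (<-≤-trans t<L L≤φv)

module Growth (G : Graph) where
  open Walks G
  open Certificates G

  record Partial : Set where
    constructor partial
    field
      seeds : List (V G)
      edges : List (Edge G)
      valid : Certificate seeds edges
  open Partial public

  Reaches : Partial → V G → Set
  Reaches s y = y ∈ seeds s ++ endpoints (edges s)

  record Extends (s s' : Partial) (c : ℕ) : Set where
    constructor extends
    field
      keeps : ∀ {y} → Reaches s y → Reaches s' y
      cost : length (edges s') ≤ length (edges s) + c
  open Extends public

  extends-refl : ∀ s → Extends s s 0
  extends-refl s = extends (λ p → p) (≤-reflexive (sym (+-identityʳ _)))

  extends-trans : ∀ {s s' s'' c c'} → Extends s s' c → Extends s' s'' c' → Extends s s'' (c + c')
  extends-trans {s} {c = c} {c'} (extends keeps₁ cost₁) (extends keeps₂ cost₂) =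
    extends (keeps₂ ∘ keeps₁)
      (≤-trans cost₂ (≤-trans (+-monoˡ-≤ c' cost₁) (≤-reflexive (+-assoc (length (edges s)) c c'))))

  extends-weaken : ∀ {s s' c c'} → c ≤ c' → Extends s s' c → Extends s s' c'
  extends-weaken {s} c≤c' (extends keeps cost) = extends keeps (≤-trans cost (+-monoʳ-≤ (length (edges s)) c≤c'))

  Grow : Partial → ℕ → (Partial → Set) → Set
  Grow s c P = Σ Partial λ s' → Extends s s' c × P s'

  single : V G → Partial
  single v = partial (v ∷ []) [] ([] , all-connected λ { (here refl) (here refl) → here })

  attach : (s : Partial) → ∀ v {w} → Reaches s w → Adj G v w → Grow s 1 (λ s' → Reaches s' v)
  attach (partial X Es (isEdge , conn)) v {w} w∈ vw =
    partial (v ∷ X) ((v , w) ∷ Es) (vw ∷ isEdge , all-connected λ p q → to-w p ++ʷ reverseʷ (to-w q)) ,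
    extends keep (≤-reflexive (+-comm 1 (length Es))) , here refl
    where
    Es' = (v , w) ∷ Es
    classify : ∀ {y} → y ∈ (v ∷ X) ++ endpoints Es' → y ≡ v ⊎ y ≡ w ⊎ y ∈ X ++ endpoints Es
    classify (here p) = inj₁ p
    classify (there q) with ∈-++⁻ X q
    ... | inj₁ q' = inj₂ (inj₂ (∈-++⁺ˡ q'))
    ... | inj₂ (here p) = inj₁ p
    ... | inj₂ (there (here p)) = inj₂ (inj₁ p)
    ... | inj₂ (there (there q')) = inj₂ (inj₂ (∈-++⁺ʳ X q'))
    to-w : ∀ {y} → y ∈ (v ∷ X) ++ endpoints Es' → Walk G Es' y w
    to-w p with classify p
    ... | inj₁ refl = first-edgeʷ
    ... | inj₂ (inj₁ refl) = here
    ... | inj₂ (inj₂ q) = weakenʷ (walk-between conn q w∈)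
    keep : ∀ {y} → y ∈ X ++ endpoints Es → y ∈ (v ∷ X) ++ endpoints Es'
    keep p with ∈-++⁻ X p
    ... | inj₁ q = there (∈-++⁺ˡ q)
    ... | inj₂ q = there (∈-++⁺ʳ X (there (there q)))

  total : (V G → ℕ) → List (V G) → ℕ
  total c [] = 0
  total c (y ∷ L) = c y + total c L

  total-ones : ∀ L → total (λ _ → 1) L ≡ length L
  total-ones [] = refl
  total-ones (y ∷ L) = cong suc (total-ones L)

  attach-all : (Inv : Partial → Set) → (∀ {s s' c} → Extends s s' c → Inv s → Inv s') →
    (Q : V G → Set) → (c : V G → ℕ) →
    (∀ s y → Inv s → Q y → Grow s (c y) (λ s' → Reaches s' y)) →
    ∀ L s → All Q L → Inv s → Grow s (total c L) (λ s' → All (Reaches s') L)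
  attach-all Inv inv-mono Q c attach-one [] s _ _ = s , extends-refl s , []
  attach-all Inv inv-mono Q c attach-one (y ∷ L) s (Qy ∷ QL) inv
    with attach-one s y inv Qy
  ... | s₁ , ext₁ , y∈ with attach-all Inv inv-mono Q c attach-one L s₁ QL (inv-mono ext₁ inv)
  ...   | s₂ , ext₂ , L∈ = s₂ , extends-trans ext₁ ext₂ , keeps ext₂ y∈ ∷ L∈

  partial⇒certificate : ∀ s S → All (Reaches s) S → Certificate S (edges s)
  partial⇒certificate (partial X Es (isEdge , conn)) S S-reached =
    isEdge , all-connected λ p q → walk-between conn (reached p) (reached q)
    where
    reached : ∀ {y} → y ∈ S ++ endpoints Es → y ∈ X ++ endpoints Es
    reached p with ∈-++⁻ S p
    ... | inj₁ q = All.lookup S-reached q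
    ... | inj₂ q = ∈-++⁺ʳ X q

  module AlongPath (e : ℕ → V G) (N : ℕ)
      (e-adj : ∀ t → t < N → Adj G (e t) (e (suc t)) × Adj G (e (suc t)) (e t)) where

    ReachesSegment : ℕ → ℕ → Partial → Set
    ReachesSegment i j s = ∀ x → i ≤ x → x ≤ j → Reaches s (e x)

    private
      squeeze : ∀ {i x} → i ≤ x → x ≤ i + 0 → x ≡ i
      squeeze {i} i≤x x≤i = ≤-antisym (≤-trans x≤i (≤-reflexive (+-identityʳ i))) i≤x

      top : ∀ {i d x} → x ≤ i + suc d → ¬ x ≤ i + d → x ≡ suc (i + d)
      top {i} {d} x≤ x≰ = ≤-antisym (≤-trans x≤ (≤-reflexive (+-suc i d))) (≰⇒> x≰)

      step-adj : ∀ i d → i + suc d ≤ N → Adj G (e (i + d)) (e (suc (i + d))) × Adj G (e (suc (i + d))) (e (i + d))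
      step-adj i d le = e-adj (i + d) (≤-trans (≤-reflexive (sym (+-suc i d))) le)

      shorter : ∀ i d → i + suc d ≤ N → i + d ≤ N
      shorter i d le = ≤-trans (+-monoʳ-≤ i (n≤1+n d)) le

    grow-up : ∀ s i d → i + d ≤ N → Reaches s (e i) → Grow s d (ReachesSegment i (i + d))
    grow-up s i zero _ p = s , extends-refl s , λ x i≤x x≤ → subst (Reaches s ∘ e) (sym (squeeze i≤x x≤)) p
    grow-up s i (suc d) le p with grow-up s i d (shorter i d le) p
    ... | s₁ , ext₁ , seg₁ with attach s₁ (e (suc (i + d))) (seg₁ (i + d) (m≤m+n i d) ≤-refl) (proj₂ (step-adj i d le))
    ...   | s₂ , ext₂ , top∈ = s₂ , extends-weaken (≤-reflexive (+-comm d 1)) (extends-trans ext₁ ext₂) , seg₂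
      where
      seg₂ : ReachesSegment i (i + suc d) s₂
      seg₂ x i≤x x≤ with x ≤? i + d
      ... | yes x≤' = keeps ext₂ (seg₁ x i≤x x≤')
      ... | no x≰ = subst (Reaches s₂ ∘ e) (sym (top x≤ x≰)) top∈

    grow-down : ∀ s i d → i + d ≤ N → Reaches s (e (i + d)) → Grow s d (ReachesSegment i (i + d))
    grow-down s i zero _ p = s , extends-refl s , λ x i≤x x≤ →
      subst (Reaches s ∘ e) (trans (+-identityʳ i) (sym (squeeze i≤x x≤))) p
    grow-down s i (suc d) le p with attach s (e (i + d)) (subst (Reaches s ∘ e) (+-suc i d) p) (proj₁ (step-adj i d le))
    ... | s₁ , ext₁ , p₁ with grow-down s₁ i d (shorter i d le) p₁
    ...   | s₂ , ext₂ , seg₂ = s₂ , extends-trans ext₁ ext₂ , seg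
      where
      seg : ReachesSegment i (i + suc d) s₂
      seg x i≤x x≤ with x ≤? i + d
      ... | yes x≤' = seg₂ x i≤x x≤'
      ... | no x≰ = subst (Reaches s₂ ∘ e) (sym (top x≤ x≰))
                      (keeps ext₂ (keeps ext₁ (subst (Reaches s ∘ e) (+-suc i d) p)))

    grow-between : ∀ s p q → p ≤ N → q ≤ N → Reaches s (e p) → Grow s ∣ p - q ∣ (λ s' → Reaches s' (e q))
    grow-between s p q p≤N q≤N p∈ with p ≤? q
    ... | yes p≤q with grow-up s p (q ∸ p) (subst (_≤ N) (sym (m+[n∸m]≡n p≤q)) q≤N) p∈
    ...   | s' , ext , seg = s' , extends-weaken (≤-reflexive (sym (m≤n⇒∣m-n∣≡n∸m p≤q))) ext ,
                             seg q p≤q (≤-reflexive (sym (m+[n∸m]≡n p≤q)))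
    grow-between s p q p≤N q≤N p∈ | no p≰q with ≰⇒> p≰q
    ... | q<p with grow-down s q (p ∸ q) (subst (_≤ N) (sym (m+[n∸m]≡n (<⇒≤ q<p))) p≤N)
                     (subst (Reaches s ∘ e) (sym (m+[n∸m]≡n (<⇒≤ q<p))) p∈)
    ...   | s' , ext , seg = s' , extends-weaken (≤-reflexive (sym (m≤n⇒∣n-m∣≡n∸m (<⇒≤ q<p)))) ext ,
                             seg q ≤-refl (m≤m+n q _)

module FiniteGraph (G : Graph) (_≟_ : DecidableEquality (V G))
    (adj? : ∀ u v → Dec (Adj G u v)) (searchV : Searchable (V G)) where
  open Walks G
  open Certificates G

  walk? : ∀ Es u v → Dec (Walk G Es u v)
  walk? [] u v with u ≟ v
  ... | yes refl = yes here
  ... | no u≢v = no (u≢v ∘ walk-[])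
  walk? ((a , b) ∷ Es) u v = map′ join-first-edge split-first-edge
    (walk? Es u v ⊎-dec ((walk? Es u a ×-dec walk? Es b v) ⊎-dec (walk? Es u b ×-dec walk? Es a v)))

  certificate? : ∀ S Es → Dec (Certificate S Es)
  certificate? S Es = All.all? (λ e → adj? (proj₁ e) (proj₂ e)) Es ×-dec
    All.all? (λ u → All.all? (λ v → walk? Es u v) (S ++ endpoints Es)) (S ++ endpoints Es)

  -- Induction on Es: removing the
  -- first edge ab either changes nothing or forces a or b to become a new
  -- representative.
  representatives-bound : ∀ Es X R → Unique X → (∀ {x} → x ∈ X → ∃ λ r → r ∈ R × Walk G Es x r) →
    length X ≤ length R + length Es
  representatives-bound [] X R uX rep = ≤-trans
    (unique-⊆-length X R uX (λ x∈ → let r , r∈ , w = rep x∈ in subst (_∈ R) (sym (walk-[] w)) r∈))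
    (m≤m+n _ 0)
  representatives-bound ((a , b) ∷ Es) X R uX rep with Any.any? (λ r → walk? Es b r) R
  ... | yes b→R = ≤-trans (representatives-bound Es X (a ∷ R) uX rep') (≤-reflexive (sym (+-suc (length R) (length Es))))
    where
    rep' : ∀ {x} → x ∈ X → ∃ λ r → r ∈ a ∷ R × Walk G Es x r
    rep' x∈ with rep x∈
    ... | r , r∈ , w with split-first-edge w
    ... | inj₁ w' = r , there r∈ , w'
    ... | inj₂ (inj₁ (x→a , _)) = a , here refl , x→a
    ... | inj₂ (inj₂ (x→b , _)) = let r' , r'∈ , b→r' = find b→R in r' , there r'∈ , x→b ++ʷ b→r'
  ... | no ¬b→R with Any.any? (λ r → walk? Es a r) R
  ...   | yes a→R = ≤-trans (representatives-bound Es X (b ∷ R) uX rep') (≤-reflexive (sym (+-suc (length R) (length Es))))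
    where
    rep' : ∀ {x} → x ∈ X → ∃ λ r → r ∈ b ∷ R × Walk G Es x r
    rep' x∈ with rep x∈
    ... | r , r∈ , w with split-first-edge w
    ... | inj₁ w' = r , there r∈ , w'
    ... | inj₂ (inj₁ (x→a , _)) = let r' , r'∈ , a→r' = find a→R in r' , there r'∈ , x→a ++ʷ a→r'
    ... | inj₂ (inj₂ (x→b , _)) = b , here refl , x→b
  ...   | no ¬a→R = ≤-trans (representatives-bound Es X R uX rep') (+-monoʳ-≤ (length R) (n≤1+n _))
    where
    rep' : ∀ {x} → x ∈ X → ∃ λ r → r ∈ R × Walk G Es x r
    rep' x∈ with rep x∈
    ... | r , r∈ , w with split-first-edge w
    ... | inj₁ w' = r , r∈ , w'
    ... | inj₂ (inj₁ (_ , b→r)) = ⊥-elim (¬b→R (Any.map (λ eq → subst (Walk G Es b) eq b→r) r∈))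
    ... | inj₂ (inj₂ (_ , a→r)) = ⊥-elim (¬a→R (Any.map (λ eq → subst (Walk G Es a) eq a→r) r∈))

  kSubset-lower-bound : ∀ k S → KSubset G k S → SteinerLowerBound S (k ∸ 1)
  kSubset-lower-bound k [] (_ , refl) H _ = z≤n
  kSubset-lower-bound k (x ∷ S) (uS , refl) H (conn , S⊆W) = ≤-pred
    (representatives-bound (E H) (x ∷ S) (x ∷ []) uS
      λ y∈ → x , here refl , conn (All.lookup S⊆W y∈) (All.lookup S⊆W (here refl)))

  same-edge? : ∀ e f → Dec (SameEdge G e f)
  same-edge? (a , b) (c , d) = (a ≟ c ×-dec b ≟ d) ⊎-dec (a ≟ d ×-dec b ≟ c)

  dedup-edges : List (Edge G) → List (Edge G)
  dedup-edges [] = []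
  dedup-edges (e ∷ Es) with Any.any? (same-edge? e) Es
  ... | yes _ = dedup-edges Es
  ... | no _ = e ∷ dedup-edges Es

  dedup-edges-⊆ : ∀ Es {x} → x ∈ dedup-edges Es → x ∈ Es
  dedup-edges-⊆ (e ∷ Es) p with Any.any? (same-edge? e) Es
  dedup-edges-⊆ (e ∷ Es) p | yes _ = there (dedup-edges-⊆ Es p)
  dedup-edges-⊆ (e ∷ Es) (here q) | no _ = here q
  dedup-edges-⊆ (e ∷ Es) (there q) | no _ = there (dedup-edges-⊆ Es q)

  length-dedup-edges : ∀ Es → length (dedup-edges Es) ≤ length Es
  length-dedup-edges [] = z≤n
  length-dedup-edges (e ∷ Es) with Any.any? (same-edge? e) Es
  ... | yes _ = m≤n⇒m≤1+n (length-dedup-edges Es)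
  ... | no _ = s≤s (length-dedup-edges Es)

  dedup-edges-distinct : ∀ Es → AllPairs (λ e f → ¬ SameEdge G e f) (dedup-edges Es)
  dedup-edges-distinct [] = []
  dedup-edges-distinct (e ∷ Es) with Any.any? (same-edge? e) Es
  ... | yes _ = dedup-edges-distinct Es
  ... | no ¬same = All.tabulate (λ x∈ same → ¬same (Any.map (λ eq → subst (SameEdge G e) eq same) (dedup-edges-⊆ Es x∈)))
                   ∷ dedup-edges-distinct Es

  dedup-edges-keeps : ∀ Es {u w} → (u , w) ∈ Es → EdgeIn G (dedup-edges Es) u w
  dedup-edges-keeps (e ∷ Es) p with Any.any? (same-edge? e) Es | p
  ... | yes same | here refl with find same
  ...   | (c , d) , f∈ , inj₁ (refl , refl) = dedup-edges-keeps Es f∈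
  ...   | (c , d) , f∈ , inj₂ (refl , refl) = swap⊎ (dedup-edges-keeps Es f∈)
  dedup-edges-keeps (e ∷ Es) p | yes _ | there q = dedup-edges-keeps Es q
  dedup-edges-keeps (e ∷ Es) p | no _ | here refl = inj₁ (here refl)
  dedup-edges-keeps (e ∷ Es) p | no _ | there q = map⊎ there there (dedup-edges-keeps Es q)

  walk-dedup : ∀ Es {u v} → Walk G Es u v → Walk G (dedup-edges Es) u v
  walk-dedup Es here = here
  walk-dedup Es (step (inj₁ p) w) = step (dedup-edges-keeps Es p) (walk-dedup Es w)
  walk-dedup Es (step (inj₂ p) w) = step (swap⊎ (dedup-edges-keeps Es p)) (walk-dedup Es w)

  certificate⇒spanning : ∀ S Es → Certificate S Es → Σ (Subgraph G) λ H → Spans G S H × numEdges G H ≤ length Es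
  certificate⇒spanning S Es (isEdge , conn) = H , (connected , S⊆W) , length-dedup-edges Es
    where
    X = S ++ endpoints Es
    H : Subgraph G
    H = record
      { W = deduplicate _≟_ X
      ; E = dedup-edges Es
      ; W-uniq = Unique.deduplicate-! _≟_ X
      ; E-uniq = dedup-edges-distinct Es
      ; E-adj = All.tabulate (λ e∈ → All.lookup isEdge (dedup-edges-⊆ Es e∈))
      ; E-ends = All.tabulate (λ e∈ → let q₁ , q₂ = ∈-endpoints Es (dedup-edges-⊆ Es e∈) in
          ∈-deduplicate⁺ _≟_ (∈-++⁺ʳ S q₁) , ∈-deduplicate⁺ _≟_ (∈-++⁺ʳ S q₂)) }
    connected : Connected G H
    connected u∈ v∈ = walk-dedup Es (walk-between conn (∈-deduplicate⁻ _≟_ X u∈) (∈-deduplicate⁻ _≟_ X v∈))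
    S⊆W : All (λ s → s ∈ W H) S
    S⊆W = All.tabulate (λ s∈ → ∈-deduplicate⁺ _≟_ (∈-++⁺ˡ s∈))

  small⇒lower-≤ : ∀ {S b L} → SmallCertificate S b → SteinerLowerBound S L → L ≤ b
  small⇒lower-≤ {S} (Es , len≤ , cert) lower =
    let H , spans , H≤ = certificate⇒spanning S Es cert in ≤-trans (lower H spans) (≤-trans H≤ len≤)

  no-small⇒lower : ∀ {S b} → ¬ SmallCertificate S b → SteinerLowerBound S (suc b)
  no-small⇒lower {S} {b} ¬small H spans with numEdges G H ≤? b
  ... | yes H≤b = ⊥-elim (¬small (E H , H≤b , spanning⇒certificate S H spans))
  ... | no H≰b = ≰⇒> H≰b

  steiner-exact : ∀ {S D} → SmallCertificate S D → SteinerLowerBound S D → IsSteinerDist G S D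
  steiner-exact {S} small@(Es , len≤ , cert) lower =
    let H , spans , H≤ = certificate⇒spanning S Es cert
    in (H , spans , ≤-antisym (≤-trans H≤ len≤) (lower H spans)) , lower

  smallCertificate? : ∀ S b → Dec (SmallCertificate S b)
  smallCertificate? S b = map′ from-vector to-vector
    (anyUpTo? (λ j → searchable-Vec (searchable-× searchV searchV) j (certificate? S ∘ toList)) (suc b))
    where
    from-vector : (∃ λ j → j < suc b × Σ (Vec (Edge G) j) (Certificate S ∘ toList)) → SmallCertificate S b
    from-vector (j , j<1+b , v , cert) = toList v , subst (_≤ b) (sym (length-toList v)) (≤-pred j<1+b) , cert
    to-vector : SmallCertificate S b → ∃ λ j → j < suc b × Σ (Vec (Edge G) j) (Certificate S ∘ toList)
    to-vector (Es , len≤ , cert) = length Es , s≤s len≤ , fromList Es , subst (Certificate S) (sym (toList∘fromList Es)) cert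

  -- Existence of sdiam_k.  B is a uniform bound when every k-subset (listed as
  -- a vector, so that k-subsets can be searched) has a certificate of size ≤ B.
  UniformBound : ℕ → ℕ → Set
  UniformBound k B = ∀ (v : Vec (V G) k) → KSubset G k (toList v) → SmallCertificate (toList v) B

  kSubset? : ∀ k S → Dec (KSubset G k S)
  kSubset? k S = allPairs? (λ x y → ¬? (x ≟ y)) S ×-dec (length S ℕ.≟ k)

  uniform-or-hard : ∀ k B → UniformBound k B ⊎
    Σ (Vec (V G) k) λ v → KSubset G k (toList v) × ¬ SmallCertificate (toList v) B
  uniform-or-hard k B with searchable-Vec searchV k (λ v → kSubset? k (toList v) ×-dec ¬? (smallCertificate? (toList v) B))
  ... | yes (v , ks , ¬small) = inj₂ (v , ks , ¬small)
  ... | no none = inj₁ λ v ks → decidable-stable (smallCertificate? (toList v) B) (λ ¬small → none (v , ks , ¬small))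

  uniformBound? : ∀ k B → Dec (UniformBound k B)
  uniformBound? k B with uniform-or-hard k B
  ... | inj₁ uniform = yes uniform
  ... | inj₂ (v , ks , ¬small) = no λ uniform → ¬small (uniform v ks)

  as-vector : ∀ k (S : List (V G)) → length S ≡ k → Σ (Vec (V G) k) λ v → toList v ≡ S
  as-vector zero [] refl = []ᵛ , refl
  as-vector (suc k) (x ∷ S) eq = let v , e = as-vector k S (suc-injective eq) in (x ∷ᵛ v) , cong (x ∷_) e

  uniform-bound-list : ∀ {k B} → UniformBound k B → ∀ S → KSubset G k S → SmallCertificate S B
  uniform-bound-list {k} uniform S ks with as-vector k S (proj₂ ks)
  ... | v , refl = uniform v ks

  least-bound-attained : ∀ k D → UniformBound k D → (∀ j → j < D → ¬ UniformBound k j) →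
    (S₀ : List (V G)) → KSubset G k S₀ → Σ (List (V G)) λ S → KSubset G k S × IsSteinerDist G S D
  least-bound-attained k zero uniform _ S₀ ks₀ =
    S₀ , ks₀ , steiner-exact (uniform-bound-list uniform S₀ ks₀) (λ _ _ → z≤n)
  least-bound-attained k (suc b) uniform least _ _ with uniform-or-hard k b
  ... | inj₁ uniform-b = ⊥-elim (least b ≤-refl uniform-b)
  ... | inj₂ (v , ks , ¬small) = toList v , ks ,
    steiner-exact (uniform-bound-list uniform (toList v) ks) (no-small⇒lower ¬small)

  sdiam-exists : ∀ k U → (∀ S → KSubset G k S → SmallCertificate S U) →
    (S₀ : List (V G)) → KSubset G k S₀ →
    Σ ℕ λ D → IsSdiam G k D × D ≤ U × (∀ S L → KSubset G k S → SteinerLowerBound S L → L ≤ D)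
  sdiam-exists k U bounded S₀ ks₀ =
    D , (dominates , least-bound-attained k D uniform least S₀ ks₀) , ≤-pred D<1+U , lower≤D
    where
    search = least-witness (uniformBound? k) (suc U) (U , ≤-refl , λ v ks → bounded (toList v) ks)
    D = proj₁ search
    uniform = proj₁ (proj₂ search)
    D<1+U = proj₁ (proj₂ (proj₂ search))
    least = proj₂ (proj₂ (proj₂ search))
    lower≤D : ∀ S L → KSubset G k S → SteinerLowerBound S L → L ≤ D
    lower≤D S L ks = small⇒lower-≤ (uniform-bound-list uniform S ks)
    dominates : ∀ S d → KSubset G k S → IsSteinerDist G S d → d ≤ D
    dominates S d ks (_ , minimal) = lower≤D S d ks minimal

module Homomorphism (G G' : Graph) (f : V G → V G') (f-adj : ∀ {a b} → Adj G a b → Adj G' (f a) (f b)) where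
  module C = Certificates G
  module C' = Certificates G'

  mapEdge : Edge G → Edge G'
  mapEdge (a , b) = f a , f b

  endpoints-map : ∀ Es → C'.endpoints (map mapEdge Es) ≡ map f (C.endpoints Es)
  endpoints-map [] = refl
  endpoints-map ((a , b) ∷ Es) = cong (λ z → f a ∷ f b ∷ z) (endpoints-map Es)

  walk-map : ∀ {Es u v} → Walk G Es u v → Walk G' (map mapEdge Es) (f u) (f v)
  walk-map here = here
  walk-map (step (inj₁ p) w) = step (inj₁ (∈-map⁺ mapEdge p)) (walk-map w)
  walk-map (step (inj₂ p) w) = step (inj₂ (∈-map⁺ mapEdge p)) (walk-map w)

  certificate-map : ∀ S Es → C.Certificate S Es → C'.Certificate (map f S) (map mapEdge Es)
  certificate-map S Es (isEdge , conn) = All.map⁺ (All.map f-adj isEdge) , C'.all-connected walk'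
    where
    reached≡ : map f S ++ C'.endpoints (map mapEdge Es) ≡ map f (S ++ C.endpoints Es)
    reached≡ = trans (cong (map f S ++_) (endpoints-map Es)) (sym (map-++ f S (C.endpoints Es)))
    walk' : ∀ {u v} → u ∈ map f S ++ C'.endpoints (map mapEdge Es) → v ∈ map f S ++ C'.endpoints (map mapEdge Es) →
            Walk G' (map mapEdge Es) u v
    walk' p q with ∈-map⁻ f (subst (_ ∈_) reached≡ p) | ∈-map⁻ f (subst (_ ∈_) reached≡ q)
    ... | x , x∈ , refl | y , y∈ , refl = walk-map (C.walk-between conn x∈ y∈)

-- The vertex t of P_(N+1), clamped to N when t > N.
clamp : (N : ℕ) → ℕ → Fin (suc N)
clamp zero _ = fzero
clamp (suc N) zero = fzero
clamp (suc N) (suc t) = fsuc (clamp N t)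

toℕ-clamp : ∀ N t → t ≤ N → toℕ (clamp N t) ≡ t
toℕ-clamp zero zero _ = refl
toℕ-clamp (suc N) zero _ = refl
toℕ-clamp (suc N) (suc t) (s≤s t≤N) = cong suc (toℕ-clamp N t t≤N)

clamp-toℕ : ∀ N (i : Fin (suc N)) → clamp N (toℕ i) ≡ i
clamp-toℕ zero fzero = refl
clamp-toℕ (suc N) fzero = refl
clamp-toℕ (suc N) (fsuc i) = cong fsuc (clamp-toℕ N i)

clamp-suc : ∀ N t → t < N → toℕ (clamp N (suc t)) ≡ suc (toℕ (clamp N t))
clamp-suc N t t<N = trans (toℕ-clamp N (suc t) t<N) (cong suc (sym (toℕ-clamp N t (<⇒≤ t<N))))

path-step : ∀ {x y} → x ≡ suc y ⊎ y ≡ suc x → x ≤ suc y × y ≤ suc x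
path-step {x} {y} (inj₁ eq) = ≤-reflexive eq , ≤-trans (n≤1+n y) (≤-trans (≤-reflexive (sym eq)) (n≤1+n x))
path-step {x} {y} (inj₂ eq) = ≤-trans (n≤1+n x) (≤-trans (≤-reflexive (sym eq)) (n≤1+n y)) , ≤-reflexive eq

adjP? : ∀ n (i j : Fin n) → Dec (Adj (P n) i j)
adjP? n i j = (toℕ i ℕ.≟ suc (toℕ j)) ⊎-dec (toℕ j ℕ.≟ suc (toℕ i))

_≟V_ : ∀ {n m} → DecidableEquality (Fin n × Fin m)
_≟V_ = ≡-dec Fin._≟_ Fin._≟_

searchable-Fin : ∀ {n} → Searchable (Fin n)
searchable-Fin = Fin.any?

searchable-V : ∀ {n m} → Searchable (Fin n × Fin m)
searchable-V = searchable-× searchable-Fin searchable-Fin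

length-cartesianProduct : ∀ {A B : Set} (xs : List A) (ys : List B) →
  length (cartesianProduct xs ys) ≡ length xs * length ys
length-cartesianProduct [] ys = refl
length-cartesianProduct (x ∷ xs) ys =
  trans (length-++ (map (x ,_) ys)) (cong₂ _+_ (length-map (x ,_) ys) (length-cartesianProduct xs ys))

allV : ∀ n m → List (Fin n × Fin m)
allV n m = cartesianProduct (allFin n) (allFin m)

allV-unique : ∀ n m → Unique (allV n m)
allV-unique n m = cartesianProduct⁺ (allFin⁺ n) (allFin⁺ m)

∈-allV : ∀ {n m} (v : Fin n × Fin m) → v ∈ allV n m
∈-allV (i , j) = ∈-cartesianProduct⁺ (∈-allFin i) (∈-allFin j)

length-allV : ∀ n m → length (allV n m) ≡ m * n
length-allV n m = trans (length-cartesianProduct (allFin n) (allFin m))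
  (trans (cong₂ _*_ (length-tabulate {n = n} (λ i → i)) (length-tabulate {n = m} (λ i → i))) (*-comm n m))

kSubset-through-rows : ∀ {N m} k (a b : Fin (suc N) × Fin m) → toℕ (proj₁ a) ≡ 0 → toℕ (proj₁ b) ≡ N → 1 ≤ N →
  2 ≤ k → k ≤ m * suc N → Σ (List (Fin (suc N) × Fin m)) λ S → (Unique S × length S ≡ k) × a ∈ S × b ∈ S
kSubset-through-rows {N} {m} k a b a₀ bN 1≤N 2≤k k≤ =
  Besides.kSubset-through _≟V_ a b a≢b k (allV (suc N) m) (allV-unique _ _) (∈-allV a) (∈-allV b) 2≤k
    (subst (k ≤_) (sym (length-allV (suc N) m)) k≤)
  where
  a≢b : ¬ a ≡ b
  a≢b a≡b = <⇒≢ 1≤N (trans (sym a₀) (trans (cong (toℕ ∘ proj₁) a≡b) bN))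

-- Arithmetic for the comb: the median ρ of three points of [0, N] lies within
-- total distance N of them.
distance-sum : ℕ → ℕ → ℕ → ℕ → ℕ
distance-sum ρ a b c = ∣ ρ - a ∣ + (∣ ρ - b ∣ + ∣ ρ - c ∣)

private
  sorted-cost : ∀ {p ρ q N} → p ≤ ρ → ρ ≤ q → q ≤ N → ∣ ρ - p ∣ + ∣ ρ - q ∣ ≤ N
  sorted-cost {p} {ρ} {q} {N} p≤ρ ρ≤q q≤N = begin
    ∣ ρ - p ∣ + ∣ ρ - q ∣ ≡⟨ cong₂ _+_ (m≤n⇒∣n-m∣≡n∸m p≤ρ) (m≤n⇒∣m-n∣≡n∸m ρ≤q) ⟩
    (ρ ∸ p) + (q ∸ ρ)     ≤⟨ +-monoˡ-≤ (q ∸ ρ) (m∸n≤m ρ p) ⟩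
    ρ + (q ∸ ρ)           ≡⟨ m+[n∸m]≡n ρ≤q ⟩
    q                     ≤⟨ q≤N ⟩
    N                     ∎
    where open ≤-Reasoning

  flip-sum : ∀ x y {N} → x + y ≤ N → y + x ≤ N
  flip-sum x y {N} = subst (_≤ N) (+-comm x y)

  at-a : ∀ a b c {N} → ∣ a - b ∣ + ∣ a - c ∣ ≤ N → distance-sum a a b c ≤ N
  at-a a b c = subst (λ z → z + (∣ a - b ∣ + ∣ a - c ∣) ≤ _) (sym (∣n-n∣≡0 a))

  at-b : ∀ a b c {N} → ∣ b - a ∣ + ∣ b - c ∣ ≤ N → distance-sum b a b c ≤ N
  at-b a b c = subst (λ z → ∣ b - a ∣ + (z + ∣ b - c ∣) ≤ _) (sym (∣n-n∣≡0 b))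

  at-c : ∀ a b c {N} → ∣ c - a ∣ + ∣ c - b ∣ ≤ N → distance-sum c a b c ≤ N
  at-c a b c = subst (λ z → ∣ c - a ∣ + z ≤ _)
    (sym (trans (cong (∣ c - b ∣ +_) (∣n-n∣≡0 c)) (+-identityʳ ∣ c - b ∣)))

median-of-three : ∀ a b c N → a ≤ N → b ≤ N → c ≤ N → Σ ℕ λ ρ → ρ ≤ N × distance-sum ρ a b c ≤ N
median-of-three a b c N a≤N b≤N c≤N with ≤-total a b | ≤-total b c | ≤-total a c
... | inj₁ a≤b | inj₁ b≤c | _ = b , b≤N , at-b a b c (sorted-cost a≤b b≤c c≤N)
... | inj₂ b≤a | inj₂ c≤b | _ = b , b≤N , at-b a b c (flip-sum ∣ b - c ∣ ∣ b - a ∣ (sorted-cost c≤b b≤a a≤N))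
... | inj₁ a≤b | inj₂ c≤b | inj₁ a≤c = c , c≤N , at-c a b c (sorted-cost a≤c c≤b b≤N)
... | inj₂ b≤a | inj₁ b≤c | inj₂ c≤a = c , c≤N , at-c a b c (flip-sum ∣ c - b ∣ ∣ c - a ∣ (sorted-cost b≤c c≤a a≤N))
... | inj₁ a≤b | inj₂ c≤b | inj₂ c≤a = a , a≤N , at-a a b c (flip-sum ∣ a - c ∣ ∣ a - b ∣ (sorted-cost c≤a a≤b b≤N))
... | inj₂ b≤a | inj₁ b≤c | inj₁ a≤c = a , a≤N , at-a a b c (sorted-cost b≤a a≤c c≤N)

module Grid (n' m' : ℕ) where
  G : Graph
  G = P (suc n') □ P (suc m')

  Vx : Set
  Vx = Fin (suc n') × Fin (suc m')

  adj? : ∀ u v → Dec (Adj G u v)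
  adj? u v = (proj₁ u Fin.≟ proj₁ v ×-dec adjP? (suc m') (proj₂ u) (proj₂ v))
         ⊎-dec (proj₂ u Fin.≟ proj₂ v ×-dec adjP? (suc n') (proj₁ u) (proj₁ v))

  open Certificates G public
  open Growth G
  open FiniteGraph G _≟V_ adj? searchable-V public

  row : Vx → ℕ
  row y = toℕ (proj₁ y)

  row≤ : ∀ y → row y ≤ n'
  row≤ y = Fin.toℕ≤pred[n] (proj₁ y)

  in-column : Fin (suc m') → ℕ → Vx
  in-column c t = clamp n' t , c

  in-row : Fin (suc n') → ℕ → Vx
  in-row r t = r , clamp m' t

  in-column-adj : ∀ c t → t < n' → Adj G (in-column c t) (in-column c (suc t)) × Adj G (in-column c (suc t)) (in-column c t)
  in-column-adj c t t<n' = inj₂ (refl , inj₂ (clamp-suc n' t t<n')) , inj₂ (refl , inj₁ (clamp-suc n' t t<n'))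

  in-row-adj : ∀ r t → t < m' → Adj G (in-row r t) (in-row r (suc t)) × Adj G (in-row r (suc t)) (in-row r t)
  in-row-adj r t t<m' = inj₁ (refl , inj₂ (clamp-suc m' t t<m')) , inj₁ (refl , inj₁ (clamp-suc m' t t<m'))

  -- The comb: a whole row ρ (the spine, m' edges) plus, for every vertex y of S,
  -- the column segment from row ρ to y (the teeth, |ρ - row y| edges).  With ρ
  -- the median row of the first three vertices, those three teeth cost ≤ n'.
  comb : ∀ S → 3 ≤ length S → SmallCertificate S (m' + (n' + (length S ∸ 3) * n'))
  comb (_ ∷ []) (s≤s ())
  comb (_ ∷ _ ∷ []) (s≤s (s≤s ()))
  comb (s₁ ∷ s₂ ∷ s₃ ∷ rest) _ =
    edges combed , ≤-trans (cost (extends-trans spine-ext teeth-ext)) (+-monoʳ-≤ m' teeth-cost-bound) ,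
    partial⇒certificate combed S S-reached
    where
    S = s₁ ∷ s₂ ∷ s₃ ∷ rest
    median = median-of-three (row s₁) (row s₂) (row s₃) n' (row≤ s₁) (row≤ s₂) (row≤ s₃)
    ρ = proj₁ median
    ρ≤n' = proj₁ (proj₂ median)
    r = clamp n' ρ
    spine-grown = AlongPath.grow-up (in-row r) m' (in-row-adj r) (single (in-row r 0)) 0 m' ≤-refl (here refl)
    spine = proj₁ spine-grown
    spine-ext = proj₁ (proj₂ spine-grown)
    SpineReached : Partial → Set
    SpineReached s = ∀ c → Reaches s (r , c)
    spine-reached : SpineReached spine
    spine-reached c = subst (λ z → Reaches spine (r , z)) (clamp-toℕ m' c)
      (proj₂ (proj₂ spine-grown) (toℕ c) z≤n (Fin.toℕ≤pred[n] c))
    tooth : Vx → ℕ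
    tooth y = ∣ ρ - row y ∣
    attach-tooth : ∀ s y → SpineReached s → ⊤ → Grow s (tooth y) (λ s' → Reaches s' y)
    attach-tooth s y reached _
      with AlongPath.grow-between (in-column (proj₂ y)) n' (in-column-adj (proj₂ y)) s ρ (row y) ρ≤n' (row≤ y) (reached (proj₂ y))
    ... | s' , ext , y∈ = s' , ext , subst (Reaches s') (cong (_, proj₂ y) (clamp-toℕ n' (proj₁ y))) y∈
    teeth = attach-all SpineReached (λ ext reached c → keeps ext (reached c)) (λ _ → ⊤) tooth attach-tooth
              S spine (tt ∷ tt ∷ tt ∷ All.tabulate (λ _ → tt)) spine-reached
    combed = proj₁ teeth
    teeth-ext = proj₁ (proj₂ teeth)
    S-reached = proj₂ (proj₂ teeth)
    other-teeth : ∀ L → total tooth L ≤ length L * n'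
    other-teeth [] = z≤n
    other-teeth (y ∷ L) = +-mono-≤ (≤-trans (∣m-n∣≤m⊔n ρ (row y)) (⊔-lub ρ≤n' (row≤ y))) (other-teeth L)
    teeth-cost-bound : total tooth S ≤ n' + length rest * n'
    teeth-cost-bound = begin
      tooth s₁ + (tooth s₂ + (tooth s₃ + total tooth rest)) ≡⟨ cong (tooth s₁ +_) (sym (+-assoc (tooth s₂) _ _)) ⟩
      tooth s₁ + (tooth s₂ + tooth s₃ + total tooth rest)   ≡⟨ sym (+-assoc (tooth s₁) _ _) ⟩
      distance-sum ρ (row s₁) (row s₂) (row s₃) + total tooth rest ≤⟨ +-mono-≤ (proj₂ (proj₂ median)) (other-teeth rest) ⟩
      n' + length rest * n' ∎
      where open ≤-Reasoning

  diagonal : Vx → ℕ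
  diagonal v = toℕ (proj₁ v) + toℕ (proj₂ v)

  diagonal-step : ∀ {a b} → Adj G a b → diagonal a ≤ suc (diagonal b) × diagonal b ≤ suc (diagonal a)
  diagonal-step {g , _} {_ , h'} (inj₁ (refl , ij)) = let p , q = path-step ij in shift (toℕ g) p , shift (toℕ g) q
    where
    shift : ∀ x {y z} → y ≤ suc z → x + y ≤ suc (x + z)
    shift x {y} {z} le = ≤-trans (+-monoʳ-≤ x le) (≤-reflexive (+-suc x z))
  diagonal-step {_ , h} {_ , _} (inj₂ (refl , ij)) = let p , q = path-step ij in +-monoˡ-≤ (toℕ h) p , +-monoˡ-≤ (toℕ h) q

module GridTheorem (n' m' : ℕ) (2≤n' : 2 ≤ n') where
  module A = Grid n' m'
  module B = Grid m' n'

  -- Transposition P_m □ P_n → P_n □ P_m lets the comb use the shorter side for teeth.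
  module T = Homomorphism B.G A.G swap swap⊎

  swap-swap : ∀ (S : List A.Vx) → map swap (map swap S) ≡ S
  swap-swap S = trans (sym (map-∘ S)) (map-id S)

  grid-upper : ∀ S → 3 ≤ length S → A.SmallCertificate S ((m' + n') + (length S ∸ 3) * (m' ⊓ n'))
  grid-upper S 3≤ with ≤-total n' m'
  ... | inj₁ n'≤m' = let Es , len≤ , cert = A.comb S 3≤ in Es , ≤-trans len≤ (≤-reflexive bound≡) , cert
    where
    bound≡ : m' + (n' + (length S ∸ 3) * n') ≡ (m' + n') + (length S ∸ 3) * (m' ⊓ n')
    bound≡ = trans (sym (+-assoc m' n' _)) (cong (λ z → m' + n' + (length S ∸ 3) * z) (sym (m≥n⇒m⊓n≡n n'≤m')))
  ... | inj₂ m'≤n' =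
    let Es , len≤ , cert = B.comb S' (subst (3 ≤_) (sym (length-map swap S)) 3≤)
    in map T.mapEdge Es , ≤-trans (≤-reflexive (length-map T.mapEdge Es)) (≤-trans len≤ (≤-reflexive bound≡)) ,
       subst (λ z → A.Certificate z (map T.mapEdge Es)) (swap-swap S) (T.certificate-map S' Es cert)
    where
    S' = map swap S
    bound≡ : n' + (m' + (length S' ∸ 3) * m') ≡ (m' + n') + (length S ∸ 3) * (m' ⊓ n')
    bound≡ = begin
      n' + (m' + (length S' ∸ 3) * m') ≡⟨ sym (+-assoc n' m' _) ⟩
      n' + m' + (length S' ∸ 3) * m'   ≡⟨ cong₂ (λ z w → z + (w ∸ 3) * m') (+-comm n' m') (length-map swap S) ⟩
      m' + n' + (length S ∸ 3) * m'    ≡⟨ cong (λ z → m' + n' + (length S ∸ 3) * z) (sym (m≤n⇒m⊓n≡m m'≤n')) ⟩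
      m' + n' + (length S ∸ 3) * (m' ⊓ n') ∎
      where open ≡-Reasoning

  corner₀ corner₁ : A.Vx
  corner₀ = fzero , fzero
  corner₁ = fromℕ n' , fromℕ m'

  -- Opposite corners have diagonal potential 0 and m' + n'.
  corners-lower-bound : ∀ S → corner₀ ∈ S → corner₁ ∈ S → A.SteinerLowerBound S (m' + n')
  corners-lower-bound S c₀∈ c₁∈ = PotentialBound.potential-lower-bound A.G A.diagonal A.diagonal-step
    S c₀∈ c₁∈ refl (m' + n')
    (≤-reflexive (trans (+-comm m' n') (sym (cong₂ _+_ (Fin.toℕ-fromℕ n') (Fin.toℕ-fromℕ m')))))

  result : ∀ k → 3 ≤ k → k ≤ suc m' * suc n' →
    ∃ λ D → IsSdiam A.G k D × ((suc m' + suc n') ∸ 2 ≤ D) ×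
            (D ≤ ((suc m' + suc n') ∸ 2) + (k ∸ 3) * ((suc m' ∸ 1) ⊓ (suc n' ∸ 1)))
  result k 3≤k k≤mn = D , is-sdiam , subst (_≤ D) (sym m+n∸2) lower , subst (λ z → D ≤ z + (k ∸ 3) * (m' ⊓ n')) (sym m+n∸2) D≤U
    where
    m+n∸2 : (suc m' + suc n') ∸ 2 ≡ m' + n'
    m+n∸2 = cong (_∸ 1) (+-suc m' n')
    through = kSubset-through-rows k corner₀ corner₁ refl (Fin.toℕ-fromℕ n') (≤-trans (s≤s z≤n) 2≤n')
                (≤-trans (s≤s (s≤s z≤n)) 3≤k) k≤mn
    S₀ = proj₁ through
    ks₀ = proj₁ (proj₂ through)
    upper : ∀ S → KSubset A.G k S → A.SmallCertificate S ((m' + n') + (k ∸ 3) * (m' ⊓ n'))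
    upper S (_ , refl) = grid-upper S 3≤k
    sdiam = A.sdiam-exists k _ upper S₀ ks₀
    D = proj₁ sdiam
    is-sdiam = proj₁ (proj₂ sdiam)
    D≤U = proj₁ (proj₂ (proj₂ sdiam))
    lower = proj₂ (proj₂ (proj₂ sdiam)) S₀ (m' + n') ks₀
              (corners-lower-bound S₀ (proj₁ (proj₂ (proj₂ through))) (proj₂ (proj₂ (proj₂ through))))

-- The lexicographic product P_(n'+1) ∘ P_(m'+1).  Its "layer" is the P_(n'+1)
-- coordinate; any two vertices in neighbouring layers are adjacent.
module Lex (n' m' : ℕ) (2≤n' : 2 ≤ n') where
  G : Graph
  G = P (suc n') ⊙ P (suc m')

  Vx : Set
  Vx = Fin (suc n') × Fin (suc m')

  adj? : ∀ u v → Dec (Adj G u v)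
  adj? u v = ¬? (u ≟V v) ×-dec (adjP? (suc n') (proj₁ u) (proj₁ v)
         ⊎-dec (proj₁ u Fin.≟ proj₁ v ×-dec adjP? (suc m') (proj₂ u) (proj₂ v)))

  open Certificates G public
  open Growth G
  open FiniteGraph G _≟V_ adj? searchable-V public

  layer : Vx → ℕ
  layer y = toℕ (proj₁ y)

  layer≤ : ∀ y → layer y ≤ n'
  layer≤ y = Fin.toℕ≤pred[n] (proj₁ y)

  Neighbouring : ℕ → ℕ → Set
  Neighbouring x y = x ≡ suc y ⊎ y ≡ suc x

  neighbouring-adj : ∀ {y w} → Neighbouring (layer y) (layer w) → Adj G y w
  neighbouring-adj {y} {w} nb = (λ y≡w → distinct (cong layer y≡w)) , inj₁ nb
    where
    distinct : ¬ layer y ≡ layer w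
    distinct eq = [ (λ e → 1+n≢n (trans (sym e) eq)) , (λ e → 1+n≢n (trans (sym e) (sym eq))) ]′ nb

  layer-step : ∀ {a b} → Adj G a b → layer a ≤ suc (layer b) × layer b ≤ suc (layer a)
  layer-step (_ , inj₁ nb) = path-step nb
  layer-step (_ , inj₂ (refl , _)) = n≤1+n _ , n≤1+n _

  -- Every layer has a neighbouring layer, since there are at least two layers.
  neighbouring-layer : ∀ g → g ≤ n' → Σ ℕ λ g' → g' ≤ n' × Neighbouring g g'
  neighbouring-layer g g≤n' with g <? n'
  ... | yes g<n' = suc g , g<n' , inj₂ refl
  neighbouring-layer zero _ | no 0≮n' = ⊥-elim (0≮n' (≤-trans (s≤s z≤n) 2≤n'))
  neighbouring-layer (suc g) g≤n' | no _ = g , ≤-trans (n≤1+n g) g≤n' , inj₁ refl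

  -- S inside one layer g: a star centred in a neighbouring layer, |S| edges.
  star : ∀ S g → g ≤ n' → All (λ y → layer y ≡ g) S → SmallCertificate S (length S)
  star S g g≤n' in-g = edges starred , ≤-trans (cost ext) (≤-reflexive (total-ones S)) ,
                       partial⇒certificate starred S S-reached
    where
    nb = neighbouring-layer g g≤n'
    centre : Vx
    centre = clamp n' (proj₁ nb) , fzero
    centre-layer : layer centre ≡ proj₁ nb
    centre-layer = toℕ-clamp n' (proj₁ nb) (proj₁ (proj₂ nb))
    to-centre : ∀ {y} → layer y ≡ g → Adj G y centre
    to-centre y∈g = neighbouring-adj
      (subst₂ Neighbouring (sym y∈g) (sym centre-layer) (proj₂ (proj₂ nb)))
    attach-leaf : ∀ s y → Reaches s centre → layer y ≡ g → Grow s 1 (λ s' → Reaches s' y)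
    attach-leaf s y centre∈ y∈g = attach s y centre∈ (to-centre y∈g)
    grown = attach-all (λ s → Reaches s centre) (λ ext → keeps ext) (λ y → layer y ≡ g) (λ _ → 1)
              attach-leaf S (single centre) in-g (here refl)
    starred = proj₁ grown
    ext = proj₁ (proj₂ grown)
    S-reached = proj₂ (proj₂ grown)

  -- S spread over layers lo < hi, with a ∈ S in layer lo and b ∈ S in layer hi.
  -- The column of b from layer hi down to lo + 1, plus an edge to a, is a
  -- scaffold of hi - lo ≤ n' edges meeting every layer of [lo, hi]; each of the
  -- |S| - 2 other vertices then attaches to a neighbouring layer by one edge.
  module Spread (a b : Vx) (lo<hi : layer a < layer b) where
    lo hi : ℕ
    lo = layer a
    hi = layer b

    hi≤n' : hi ≤ n'
    hi≤n' = layer≤ b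

    column : ℕ → Vx
    column t = clamp n' t , proj₂ b

    column-layer : ∀ t → t ≤ n' → layer (column t) ≡ t
    column-layer t = toℕ-clamp n' t

    column-adj : ∀ t → t < n' → Adj G (column t) (column (suc t)) × Adj G (column (suc t)) (column t)
    column-adj t t<n' = neighbouring-adj (inj₂ one-up) , neighbouring-adj (inj₁ one-up)
      where
      one-up : layer (column (suc t)) ≡ suc (layer (column t))
      one-up = trans (column-layer (suc t) t<n') (cong suc (sym (column-layer t (<⇒≤ t<n'))))

    open AlongPath column n' column-adj

    Scaffold : Partial → Set
    Scaffold s = (∀ t → suc lo ≤ t → t ≤ hi → Reaches s (column t)) × Reaches s a

    scaffold-mono : ∀ {s s' c} → Extends s s' c → Scaffold s → Scaffold s'
    scaffold-mono ext (segment , a∈s) = (λ t p q → keeps ext (segment t p q)) , keeps ext a∈s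

    scaffold : Grow (single b) (hi ∸ suc lo + 1) Scaffold
    scaffold = s₂ , extends-trans ext₁ ext₂ , segment₂ , a∈s₂
      where
      top≡hi : suc lo + (hi ∸ suc lo) ≡ hi
      top≡hi = m+[n∸m]≡n lo<hi
      column-top : column (suc lo + (hi ∸ suc lo)) ≡ b
      column-top = trans (cong column top≡hi) (cong (_, proj₂ b) (clamp-toℕ n' (proj₁ b)))
      descent = grow-down (single b) (suc lo) (hi ∸ suc lo) (subst (_≤ n') (sym top≡hi) hi≤n') (here column-top)
      s₁ = proj₁ descent
      ext₁ = proj₁ (proj₂ descent)
      joined = attach s₁ a (proj₂ (proj₂ descent) (suc lo) ≤-refl (m≤m+n _ _))
                 (neighbouring-adj (inj₂ (column-layer (suc lo) (≤-trans lo<hi hi≤n'))))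
      s₂ = proj₁ joined
      ext₂ = proj₁ (proj₂ joined)
      a∈s₂ = proj₂ (proj₂ joined)
      segment₂ : ∀ t → suc lo ≤ t → t ≤ hi → Reaches s₂ (column t)
      segment₂ t p q = keeps ext₂ (proj₂ (proj₂ descent) t p (subst (t ≤_) (sym top≡hi) q))

    scaffold-cost : hi ∸ suc lo + 1 ≤ n'
    scaffold-cost = ≤-trans (≤-reflexive (+-comm (hi ∸ suc lo) 1))
      (≤-trans (s≤s (m≤n+m (hi ∸ suc lo) lo)) (≤-trans (≤-reflexive (m+[n∸m]≡n lo<hi)) hi≤n'))

    InRange : Vx → Set
    InRange y = lo ≤ layer y × layer y ≤ hi

    -- A vertex of a layer in [lo, hi] has a neighbour in the scaffold: the
    -- column vertex one layer up, or (for layer hi) one layer down, which is a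
    -- itself when hi = lo + 1.
    attach-in-range : ∀ s y → Scaffold s → InRange y → Grow s 1 (λ s' → Reaches s' y)
    attach-in-range s y (segment , a∈s) (lo≤y , y≤hi) with layer y <? hi
    ... | yes y<hi = attach s y (segment (suc (layer y)) (s≤s lo≤y) y<hi)
                       (neighbouring-adj (inj₂ (column-layer (suc (layer y)) (≤-trans y<hi hi≤n'))))
    ... | no y≮hi with suc lo ≤? hi ∸ 1
    ...   | yes below = attach s y (segment (hi ∸ 1) below (m∸n≤m hi 1))
                          (neighbouring-adj (inj₁ (trans y≡hi (trans (sym hi-1+1)
                            (cong suc (sym (column-layer (hi ∸ 1) (≤-trans (m∸n≤m hi 1) hi≤n'))))))))
      where
      y≡hi : layer y ≡ hi
      y≡hi = ≤-antisym y≤hi (≮⇒≥ y≮hi)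
      hi-1+1 : suc (hi ∸ 1) ≡ hi
      hi-1+1 = m+[n∸m]≡n (≤-trans (s≤s z≤n) lo<hi)
    ...   | no ¬below = attach s y a∈s (neighbouring-adj (inj₁ (trans y≡hi (sym hi≡1+lo))))
      where
      y≡hi : layer y ≡ hi
      y≡hi = ≤-antisym y≤hi (≮⇒≥ y≮hi)
      hi≡1+lo : suc lo ≡ hi
      hi≡1+lo = ≤-antisym lo<hi
        (≤-trans (≤-reflexive (sym (m+[n∸m]≡n (≤-trans (s≤s z≤n) lo<hi)))) (s≤s (≤-pred (≰⇒> ¬below))))

    a≢b : ¬ a ≡ b
    a≢b a≡b = <⇒≢ lo<hi (cong layer a≡b)

    open Besides _≟V_ a b a≢b

    spread : ∀ S → a ∈ S → b ∈ S → (∀ {y} → y ∈ S → InRange y) → SmallCertificate S (n' + (length S ∸ 2))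
    spread S a∈ b∈ in-range = edges final , cost-bound , partial⇒certificate final S S-reached
      where
      rest = attach-all Scaffold scaffold-mono InRange (λ _ → 1) attach-in-range (others S) (proj₁ scaffold)
               (All.tabulate λ y∈ → in-range (proj₁ (∈-filter⁻ Other? {xs = S} y∈))) (proj₂ (proj₂ scaffold))
      final = proj₁ rest
      ext = extends-trans (proj₁ (proj₂ scaffold)) (proj₁ (proj₂ rest))
      S-reached : All (Reaches final) S
      S-reached = all-from-others S (proj₂ (proj₂ rest))
        (keeps (proj₁ (proj₂ rest)) (proj₂ (proj₂ (proj₂ scaffold)))) (keeps ext (here refl))
      others-count : length (others S) ≤ length S ∸ 2
      others-count = subst (_≤ length S ∸ 2) (m+n∸n≡m (length (others S)) 2) (∸-monoˡ-≤ 2 (length-others-≤ S a∈ b∈))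
      cost-bound : length (edges final) ≤ n' + (length S ∸ 2)
      cost-bound = begin
        length (edges final)                                 ≤⟨ cost ext ⟩
        (hi ∸ suc lo + 1) + total (λ _ → 1) (others S)       ≡⟨ cong ((hi ∸ suc lo + 1) +_) (total-ones (others S)) ⟩
        (hi ∸ suc lo + 1) + length (others S)                ≤⟨ +-mono-≤ scaffold-cost others-count ⟩
        n' + (length S ∸ 2)                                  ∎
        where open ≤-Reasoning

  -- d(S) ≤ (n - 1) + (|S| - 2) for every nonempty S, according to whether the
  -- lowest and the highest layer met by S coincide.
  lex-upper : ∀ S → 1 ≤ length S → SmallCertificate S (n' + (length S ∸ 2))
  lex-upper (x ∷ L) _ with min-by layer x L | max-by layer x L
  ... | a , a∈ , a-min | b , b∈ , b-max with layer b ≤? layer a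
  ...   | yes hi≤lo = small-weaken (≤-trans (m≤n+m∸n (suc (length L)) 2) (+-monoˡ-≤ _ 2≤n'))
          (star (x ∷ L) (layer a) (layer≤ a) (All.tabulate λ y∈ → ≤-antisym (≤-trans (b-max y∈) hi≤lo) (a-min y∈)))
  ...   | no hi≰lo = Spread.spread a b (≰⇒> hi≰lo) (x ∷ L) a∈ b∈ (λ y∈ → a-min y∈ , b-max y∈)

-- Part (2) of the proposition, for n = n' + 1 and m = m' + 1.  Both lower
-- bounds hold for every admissible k.
module LexTheorem (n' m' : ℕ) (2≤n' : 2 ≤ n') where
  module L = Lex n' m' 2≤n'

  ends₀ ends₁ : L.Vx
  ends₀ = fzero , fzero
  ends₁ = fromℕ n' , fzero

  result : ∀ k → 3 ≤ k → k ≤ suc m' * suc n' →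
    ∃ λ D → IsSdiam L.G k D × (D ≤ (suc n' + k) ∸ 3) ×
      (suc m' + 1 ≤ k → k ≤ suc m' * suc n' → suc n' ∸ 1 ≤ D) × (2 ≤ k → k ≤ suc m' → k ∸ 1 ≤ D)
  result k 3≤k k≤mn = D , is-sdiam , subst (D ≤_) (sym (+-∸-assoc n' 2≤k)) D≤U , (λ _ _ → layers-bound) , (λ _ _ → size-bound)
    where
    2≤k : 2 ≤ k
    2≤k = ≤-trans (s≤s (s≤s z≤n)) 3≤k
    through = kSubset-through-rows k ends₀ ends₁ refl (Fin.toℕ-fromℕ n') (≤-trans (s≤s z≤n) 2≤n') 2≤k k≤mn
    S₀ = proj₁ through
    ks₀ = proj₁ (proj₂ through)
    upper : ∀ S → KSubset L.G k S → L.SmallCertificate S (n' + (k ∸ 2))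
    upper S (_ , refl) = L.lex-upper S (≤-trans (s≤s z≤n) 3≤k)
    sdiam = L.sdiam-exists k _ upper S₀ ks₀
    D = proj₁ sdiam
    is-sdiam = proj₁ (proj₂ sdiam)
    D≤U = proj₁ (proj₂ (proj₂ sdiam))
    lower≤D = proj₂ (proj₂ (proj₂ sdiam)) S₀
    -- S₀ meets the first and the last layer.
    layers-bound : n' ≤ D
    layers-bound = lower≤D n' ks₀ (PotentialBound.potential-lower-bound L.G L.layer L.layer-step S₀
      (proj₁ (proj₂ (proj₂ through))) (proj₂ (proj₂ (proj₂ through))) refl n' (≤-reflexive (sym (Fin.toℕ-fromℕ n'))))
    size-bound : k ∸ 1 ≤ D
    size-bound = lower≤D (k ∸ 1) ks₀ (L.kSubset-lower-bound k S₀ ks₀)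

proposition4p2 : (k n m : ℕ) → 3 ≤ k → k ≤ m * n → 3 ≤ n → 3 ≤ m →
    (∃ λ D → IsSdiam (P n □ P m) k D ×
        ((m + n) ∸ 2 ≤ D) × (D ≤ ((m + n) ∸ 2) + (k ∸ 3) * ((m ∸ 1) ⊓ (n ∸ 1)))) ×
    (∃ λ D → IsSdiam (P n ⊙ P m) k D ×
        (D ≤ (n + k) ∸ 3) ×
        (m + 1 ≤ k → k ≤ m * n → n ∸ 1 ≤ D) ×
        (2 ≤ k → k ≤ m → k ∸ 1 ≤ D))
proposition4p2 k (suc n') (suc m') 3≤k k≤mn (s≤s 2≤n') _ =
  GridTheorem.result n' m' 2≤n' k 3≤k k≤mn , LexTheorem.result n' m' 2≤n' k 3≤k k≤mn
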